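{- The class $\{T_{2,1}, 2T_{2,2}, 3T_{2,3}, 4T_{2,4}, \ldots \}$ has unbounded depth-$2$ rank-brittleness.
   Context: $T_{2,n}$ is the $1$-subdivision of the star $K_{1,n}$ and $nT_{2,n}$ is the disjoint union of $n$ copies of it. For $S\subseteq V(G)$, the cut-rank $\rho_G(S)$ is the rank over the binary field of the $S\times (V(G)\setminus S)$ adjacency submatrix. The $\rho_G$-width of a partition $(X_1,\dots,X_m)$ of $V(G)$ is $\max\{\rho_G(\bigcup_{i\in I}X_i): I\subseteq\{1,\dots,m\}\}$. A decomposition of $G$ is a pair $(T,\sigma)$ of a tree $T$ with at least one internal node and a bijection $\sigma$ from $V(G)$ to the leaves of $T$; for an internal node $t$, the components of $T-t$ give a partition of $V(G)$, and the width of $t$ is its $\rho_G$-width; the width of $(T,\sigma)$ is the maximum over internal nodes. The depth-$2$ rank-brittleness $\mathrm{rb}_2(G)$ is the minimum width of a decomposition of $G$ whose tree has radius at most $2$ ($0$ if $|V(G)|<2$). A class has unbounded depth-$2$ rank-brittleness if $\mathrm{rb}_2$ is not bounded by any constant on the class. -}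

module Defs where

open import Data.Nat using (ℕ; zero; suc; _+_; _*_; _∸_; _≤_; _<_; _≡ᵇ_; _≤ᵇ_)
open import Data.Fin using (Fin; toℕ; remQuot)
open import Data.Bool using (Bool; true; false; _∧_; _∨_; _xor_; if_then_else_)
open import Data.Product using (Σ; ∃; _×_; _,_; proj₁; proj₂)
open import Data.Sum using (_⊎_)
open import Data.Unit using (⊤)
open import Relation.Binary.PropositionalEquality using (_≡_; _≢_)
open import Relation.Nullary using (¬_)
open import Function.Definitions using (Injective)

record Graph : Set where
  field
    N   : ℕ
    adj : Fin N → Fin N → Bool

count : ∀ {m} → (Fin m → Bool) → ℕ
count {zero}  f = 0
count {suc m} f = (if f Data.Fin.zero then 1 else 0) + count (λ i → f (Data.Fin.suc i))

sumFin : ∀ {m} → (Fin m → ℕ) → ℕ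
sumFin {zero}  f = 0
sumFin {suc m} f = f Data.Fin.zero + sumFin (λ i → f (Data.Fin.suc i))

xorSum : ∀ {m} → (Fin m → Bool) → Bool
xorSum {zero}  f = false
xorSum {suc m} f = f Data.Fin.zero xor xorSum (λ i → f (Data.Fin.suc i))

-- For S ⊆ V(G) (as a Boolean predicate), the matrix
-- has rows S and columns V(G) \ S with entries adj u v.  Its rank is at
-- least r iff there are r distinct rows that are linearly independent
-- over GF(2), i.e. no nontrivial GF(2)-combination of them vanishes on
-- every column v ∉ S.

module _ (G : Graph) where
  open Graph G

  RowsDependent : ∀ {r} → (Fin N → Bool) → (Fin r → Fin N) → Set
  RowsDependent {r} S rows =
    Σ (Fin r → Bool) λ c →
      (∃ λ i → c i ≡ true) ×
      (∀ v → S v ≡ false → xorSum (λ i → c i ∧ adj (rows i) v) ≡ false)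

  CutRankAtLeast : (Fin N → Bool) → ℕ → Set
  CutRankAtLeast S r =
    Σ (Fin r → Fin N) λ rows →
      Injective _≡_ _≡_ rows ×
      (∀ i → S (rows i) ≡ true) ×
      ¬ RowsDependent S rows

data Walk {M : ℕ} (A : Fin M → Fin M → Bool) (P : Fin M → Set)
          : Fin M → Fin M → Set where
  stay : ∀ {u} → P u → Walk A P u u
  step : ∀ {u w v} → P u → A u w ≡ true → Walk A P w v → Walk A P u v

-- A tree: a simple connected graph with |E| = |V| - 1
-- (stated as: sum of degrees = 2 (|V| - 1)).
record Tree : Set where
  field
    M         : ℕ
    A         : Fin M → Fin M → Bool
    symm      : ∀ u v → A u v ≡ A v u
    irrefl    : ∀ u → A u u ≡ false
    connected : ∀ u v → Walk A (λ _ → ⊤) u v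

  deg : Fin M → ℕ
  deg v = count (A v)

  field
    edges     : sumFin deg ≡ 2 * (M ∸ 1)

  Leaf : Fin M → Set
  Leaf v = deg v ≤ 1

  Internal : Fin M → Set
  Internal v = 2 ≤ deg v

  RadiusAtMost2 : Set
  RadiusAtMost2 =
    Σ (Fin M) λ c → ∀ v →
      (v ≡ c) ⊎ (A c v ≡ true) ⊎ (∃ λ w → A c w ≡ true × A w v ≡ true)

record Decomposition (G : Graph) : Set where
  open Graph G
  field
    tree        : Tree
  open Tree tree
  field
    σ           : Fin N → Fin M
    σ-injective : Injective _≡_ _≡_ σ
    σ-leaf      : ∀ x → Leaf (σ x)
    σ-onto      : ∀ ℓ → Leaf ℓ → ∃ λ x → σ x ≡ ℓ
    hasInternal : ∃ λ t → Internal t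

module _ {G : Graph} (D : Decomposition G) where
  open Graph G
  open Decomposition D
  open Tree tree

  -- S is a union of parts of the partition of V(G) given by the
  -- components of T - t.
  UnionOfParts : Fin M → (Fin N → Bool) → Set
  UnionOfParts t S =
    ∀ x y → Walk A (λ z → z ≢ t) (σ x) (σ y) → S x ≡ S y

  WidthAtMost : ℕ → Set
  WidthAtMost k =
    ∀ t → Internal t → ∀ S → UnionOfParts t S →
      ¬ CutRankAtLeast G S (suc k)

Rb2AtMost : Graph → ℕ → Set
Rb2AtMost G k =
  (Graph.N G < 2) ⊎
  Σ (Decomposition G) λ D →
    Tree.RadiusAtMost2 (Decomposition.tree D) × WidthAtMost D k

-- n T_{2,n}: n disjoint copies of the 1-subdivision of K_{1,n}.
-- Vertex (copy p, local a) with a ∈ {0,…,2n}: 0 is the centre,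
-- 1..n are the subdivision vertices, n+1..2n the leaves; centre–j and
-- j–(j+n) are the edges, for 1 ≤ j ≤ n.

localEdge : ℕ → ℕ → ℕ → Bool
localEdge n a b =
  ((a ≡ᵇ 0) ∧ (1 ≤ᵇ b) ∧ (b ≤ᵇ n)) ∨
  ((1 ≤ᵇ a) ∧ (a ≤ᵇ n) ∧ (b ≡ᵇ a + n))

nT2 : ℕ → Graph
nT2 n = record
  { N   = n * suc (n + n)
  ; adj = λ u v →
      let (p , a) = remQuot {n} (suc (n + n)) u
          (q , b) = remQuot {n} (suc (n + n)) v
      in (toℕ p ≡ᵇ toℕ q) ∧
         (localEdge n (toℕ a) (toℕ b) ∨ localEdge n (toℕ b) (toℕ a))
  }

module Submission where

-- Suppose every nT_{2,n} (n ≥ 1) had a decomposition of radius ≤ 2 and width ≤ k,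
-- and take n = (k+1)².  We may assume the decomposition tree has an internal
-- centre c with every node within distance 2 of c.  Each non-centre node u then
-- lies in the branch of a unique neighbour of c, and because the tree has exactly
-- |V| - 1 edges, walks avoiding c never leave a branch.  Two cuts give rank k+1:
--   * no branch contains k+1 subdivision vertices of one copy: they, together
--     with their pendant leaves, would form an induced matching across a cut at
--     the internal node "hub" of that branch;
--   * hence, by the pigeonhole principle, every copy q ≤ k has a subdivision
--     vertex outside the union S of the branches of the centres of copies 0..k,
--     and the centres together with these vertices form an induced matching
--     across S, a union of parts at c.

open import Defs
open import Data.Nat using (ℕ; zero; suc; _+_; _*_; _∸_; _≤_; _<_; z≤n; s≤s; _≡ᵇ_; _<ᵇ_; _≤ᵇ_)
open import Data.Nat.Properties
open import Data.Fin using (Fin; toℕ; combine; remQuot; _↑ˡ_; _↑ʳ_)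
open import Data.Fin.Properties using (any?)
import Data.Fin as F
import Data.Fin.Properties as FP
open import Data.Bool using (Bool; true; false; _∧_; _∨_; not; if_then_else_; T)
import Data.Bool.Properties as BP
open import Data.Product using (Σ; ∃; _×_; _,_; proj₁; proj₂)
open import Data.Sum using (_⊎_; inj₁; inj₂)
open import Data.Empty using (⊥; ⊥-elim)
open import Relation.Binary.PropositionalEquality
open import Relation.Nullary using (¬_; Dec; yes; no; does; contradiction)
open import Relation.Nullary.Decidable using (dec-true)
open import Function.Definitions using (Injective)
open import Algebra.Properties.CommutativeSemigroup +-commutativeSemigroup using (interchange)

true≢false : true ≢ false
true≢false ()

∧-true₁ : ∀ {x y} → x ∧ y ≡ true → x ≡ true
∧-true₁ {true} _ = refl

∧-true₂ : ∀ {x y} → x ∧ y ≡ true → y ≡ true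
∧-true₂ {true} e = e

∨-true : ∀ {x y} → x ∨ y ≡ true → (x ≡ true) ⊎ (y ≡ true)
∨-true {true}  _ = inj₁ refl
∨-true {false} e = inj₂ e

does-sound : ∀ {a} {A : Set a} (a? : Dec A) → does a? ≡ true → A
does-sound (yes a) _ = a

_==_ : ∀ {m} → Fin m → Fin m → Bool
i == j = does (i FP.≟ j)

==-refl : ∀ {m} (i : Fin m) → (i == i) ≡ true
==-refl i = dec-true (i FP.≟ i) refl

==-sound : ∀ {m} {i j : Fin m} → (i == j) ≡ true → i ≡ j
==-sound {i = i} {j} = does-sound (i FP.≟ j)

ind : Bool → ℕ
ind b = if b then 1 else 0

count≡sum : ∀ {m} (f : Fin m → Bool) → count f ≡ sumFin (λ i → ind (f i))
count≡sum {zero}  f = refl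
count≡sum {suc m} f = cong (ind (f F.zero) +_) (count≡sum (λ i → f (F.suc i)))

sumFin-cong : ∀ {m} {f g : Fin m → ℕ} → (∀ i → f i ≡ g i) → sumFin f ≡ sumFin g
sumFin-cong {zero}  h = refl
sumFin-cong {suc m} h = cong₂ _+_ (h F.zero) (sumFin-cong (λ i → h (F.suc i)))

sumFin-+ : ∀ {m} (f g : Fin m → ℕ) → sumFin (λ i → f i + g i) ≡ sumFin f + sumFin g
sumFin-+ {zero}  f g = refl
sumFin-+ {suc m} f g =
  trans (cong (f F.zero + g F.zero +_) (sumFin-+ (λ i → f (F.suc i)) (λ i → g (F.suc i))))
        (interchange (f F.zero) (g F.zero) _ _)

sumFin-zero : ∀ {m} → sumFin {m} (λ _ → 0) ≡ 0
sumFin-zero {zero}  = refl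
sumFin-zero {suc m} = sumFin-zero {m}

sumFin-one : ∀ {m} → sumFin {m} (λ _ → 1) ≡ m
sumFin-one {zero}  = refl
sumFin-one {suc m} = cong suc (sumFin-one {m})

sumFin-swap : ∀ {m n} (g : Fin m → Fin n → ℕ) →
  sumFin (λ i → sumFin (λ j → g i j)) ≡ sumFin (λ j → sumFin (λ i → g i j))
sumFin-swap {zero}  {n} g = sym (sumFin-zero {n})
sumFin-swap {suc m} {n} g =
  trans (cong (sumFin (g F.zero) +_) (sumFin-swap (λ i → g (F.suc i))))
        (sym (sumFin-+ (g F.zero) (λ j → sumFin (λ i → g (F.suc i) j))))

sumFin-mono : ∀ {m} {f g : Fin m → ℕ} → (∀ i → f i ≤ g i) → sumFin f ≤ sumFin g
sumFin-mono {zero}  h = z≤n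
sumFin-mono {suc m} h = +-mono-≤ (h F.zero) (sumFin-mono (λ i → h (F.suc i)))

sumFin-< : ∀ {m} {f g : Fin m → ℕ} → (∀ i → f i ≤ g i) → ∀ k → f k < g k → sumFin f < sumFin g
sumFin-< h F.zero    lt = +-mono-<-≤ lt (sumFin-mono (λ i → h (F.suc i)))
sumFin-< h (F.suc k) lt = +-mono-≤-< (h F.zero) (sumFin-< (λ i → h (F.suc i)) k lt)

_⊆ᵇ_ : ∀ {m} → (Fin m → Bool) → (Fin m → Bool) → Set
f ⊆ᵇ g = ∀ i → f i ≡ true → g i ≡ true

ind-mono : ∀ {a b} → (a ≡ true → b ≡ true) → ind a ≤ ind b
ind-mono {false} _ = z≤n
ind-mono {true}  h rewrite h refl = ≤-refl

count-⊆ : ∀ {m} {f g : Fin m → Bool} → f ⊆ᵇ g → count f ≤ count g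
count-⊆ {f = f} {g} h =
  subst₂ _≤_ (sym (count≡sum f)) (sym (count≡sum g)) (sumFin-mono (λ i → ind-mono (h i)))

count-⊂ : ∀ {m} {f g : Fin m → Bool} → f ⊆ᵇ g → ∀ k → f k ≡ false → g k ≡ true →
  count f < count g
count-⊂ {f = f} {g} h k fk gk =
  subst₂ _<_ (sym (count≡sum f)) (sym (count≡sum g))
    (sumFin-< (λ i → ind-mono (h i)) k (subst₂ (λ a b → ind a < ind b) (sym fk) (sym gk) ≤-refl))

count-∨ : ∀ {m} (f g : Fin m → Bool) → (∀ i → f i ∧ g i ≡ false) →
  count (λ i → f i ∨ g i) ≡ count f + count g
count-∨ {zero}  f g h = refl
count-∨ {suc m} f g h with f F.zero | g F.zero | h F.zero
... | false | false | _ = count-∨ _ _ (λ i → h (F.suc i))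
... | false | true  | _ = trans (cong suc (count-∨ _ _ (λ i → h (F.suc i)))) (sym (+-suc _ _))
... | true  | false | _ = cong suc (count-∨ _ _ (λ i → h (F.suc i)))

count-false : ∀ {m} → count {m} (λ _ → false) ≡ 0
count-false {zero}  = refl
count-false {suc m} = count-false {m}

count-single : ∀ {m} (i : Fin m) → count (λ j → i == j) ≡ 1
count-single {suc m} F.zero    = cong suc (count-false {m})
count-single {suc m} (F.suc i) = count-single i

count-not : ∀ {m} (f : Fin m → Bool) → count (λ i → not (f i)) + count f ≡ m
count-not {zero}  f = refl
count-not {suc m} f with f F.zero
... | true  = trans (+-suc _ _) (cong suc (count-not _))
... | false = cong suc (count-not _)

count-≥1 : ∀ {m} (f : Fin m → Bool) (a : Fin m) → f a ≡ true → 1 ≤ count f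
count-≥1 f F.zero    fa rewrite fa = s≤s z≤n
count-≥1 f (F.suc a) fa = ≤-trans (count-≥1 _ a fa) (m≤n+m _ _)

count-≥2 : ∀ {m} (f : Fin m → Bool) (a b : Fin m) → f a ≡ true → f b ≡ true → a ≢ b →
  2 ≤ count f
count-≥2 f F.zero    F.zero    fa fb a≢b = contradiction refl a≢b
count-≥2 f F.zero    (F.suc b) fa fb a≢b rewrite fa = s≤s (count-≥1 _ b fb)
count-≥2 f (F.suc a) F.zero    fa fb a≢b rewrite fb = s≤s (count-≥1 _ a fa)
count-≥2 f (F.suc a) (F.suc b) fa fb a≢b =
  ≤-trans (count-≥2 _ a b fa fb (λ e → a≢b (cong F.suc e))) (m≤n+m _ _)

count-≤1-unique : ∀ {m} (f : Fin m → Bool) (a b : Fin m) → count f ≤ 1 →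
  f a ≡ true → f b ≡ true → a ≡ b
count-≤1-unique f a b le fa fb with a FP.≟ b
... | yes a≡b = a≡b
... | no  a≢b = contradiction (≤-trans (count-≥2 f a b fa fb a≢b) le) 1+n≰n

enumerate : ∀ {m} (f : Fin m → Bool) s → s ≤ count f →
  Σ (Fin s → Fin m) λ g → Injective _≡_ _≡_ g × (∀ i → f (g i) ≡ true)
enumerate f zero _ = (λ ()) , (λ { {()} }) , (λ ())
enumerate {zero} f (suc s) ()
enumerate {suc m} f (suc s) le with f F.zero in f0
... | true =
  let (g , g-inj , fg) = enumerate (λ i → f (F.suc i)) s (≤-pred le)
  in  cons g , cons-inj g-inj , cons-sat fg
  where
  cons : (Fin s → Fin m) → Fin (suc s) → Fin (suc m)
  cons g F.zero    = F.zero
  cons g (F.suc i) = F.suc (g i)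
  cons-inj : ∀ {g} → Injective _≡_ _≡_ g → Injective _≡_ _≡_ (cons g)
  cons-inj g-inj {F.zero}  {F.zero}  _ = refl
  cons-inj g-inj {F.suc x} {F.suc y} e = cong F.suc (g-inj (FP.suc-injective e))
  cons-sat : ∀ {g} → (∀ i → f (F.suc (g i)) ≡ true) → ∀ i → f (cons g i) ≡ true
  cons-sat fg F.zero    = f0
  cons-sat fg (F.suc i) = fg i
... | false =
  let (g , g-inj , fg) = enumerate (λ i → f (F.suc i)) (suc s) le
  in  (λ i → F.suc (g i)) , (λ e → g-inj (FP.suc-injective e)) , fg

fibres-sum : ∀ {m r} (f : Fin m → Fin r) → sumFin (λ v → count (λ j → f j == v)) ≡ m
fibres-sum {m} f = begin
  sumFin (λ v → count (λ j → f j == v))            ≡⟨ sumFin-cong (λ v → count≡sum (λ j → f j == v)) ⟩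
  sumFin (λ v → sumFin (λ j → ind (f j == v)))     ≡⟨ sym (sumFin-swap (λ j v → ind (f j == v))) ⟩
  sumFin (λ j → sumFin (λ v → ind (f j == v)))     ≡⟨ sumFin-cong (λ j → sym (count≡sum (λ v → f j == v))) ⟩
  sumFin (λ j → count (λ v → f j == v))            ≡⟨ sumFin-cong (λ j → count-single (f j)) ⟩
  sumFin {m} (λ _ → 1)                             ≡⟨ sumFin-one ⟩
  m                                                ∎
  where open ≡-Reasoning

sum-pigeonhole : ∀ r s (g : Fin r → ℕ) → r * s < sumFin g → Σ (Fin r) λ v → s < g v
sum-pigeonhole zero    s g ()
sum-pigeonhole (suc r) s g lt with s <? g F.zero
... | yes s<g₀ = F.zero , s<g₀
... | no  s≮g₀ =
  let (v , s<gv) = sum-pigeonhole r s (λ i → g (F.suc i))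
                     (+-cancelˡ-< s _ _ (<-≤-trans lt (+-monoˡ-≤ _ (≮⇒≥ s≮g₀))))
  in  F.suc v , s<gv

pigeonhole : ∀ {m r} s (f : Fin m → Fin r) → r * s < m →
  Σ (Fin r) λ v → Σ (Fin (suc s) → Fin m) λ g → Injective _≡_ _≡_ g × (∀ i → f (g i) ≡ v)
pigeonhole {r = r} s f lt =
  let (v , s<fibre) = sum-pigeonhole r s (λ v → count (λ j → f j == v))
                        (subst (r * s <_) (sym (fibres-sum f)) lt)
      (g , g-inj , fg) = enumerate (λ j → f j == v) (suc s) s<fibre
  in  v , g , g-inj , (λ i → ==-sound (fg i))

xorSum-false : ∀ {m} (g : Fin m → Bool) → (∀ j → g j ≡ false) → xorSum g ≡ false
xorSum-false {zero}  g h = refl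
xorSum-false {suc m} g h rewrite h F.zero = xorSum-false _ (λ j → h (F.suc j))

xorSum-single : ∀ {m} (g : Fin m → Bool) (k : Fin m) → (∀ j → j ≢ k → g j ≡ false) →
  xorSum g ≡ g k
xorSum-single g F.zero h
  rewrite xorSum-false (λ i → g (F.suc i)) (λ j → h (F.suc j) (λ ())) = BP.xor-identityʳ (g F.zero)
xorSum-single g (F.suc k) h rewrite h F.zero (λ ()) =
  xorSum-single _ k (λ j j≢k → h (F.suc j) (λ e → j≢k (FP.suc-injective e)))

-- An induced matching rows i – cols i across the cut (S, V∖S) shows ρ(S) ≥ r:
-- on these rows and columns the cut matrix is the identity.
matching⇒cutRank : ∀ (G : Graph) (S : Fin (Graph.N G) → Bool) {r}
  (rows cols : Fin r → Fin (Graph.N G)) →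
  (∀ i → S (rows i) ≡ true) → (∀ i → S (cols i) ≡ false) →
  (∀ i → Graph.adj G (rows i) (cols i) ≡ true) →
  (∀ i j → j ≢ i → Graph.adj G (rows j) (cols i) ≡ false) →
  CutRankAtLeast G S r
matching⇒cutRank G S rows cols S-rows S-cols diag offDiag =
  rows , rows-inj , S-rows , independent
  where
  open Graph G
  rows-inj : Injective _≡_ _≡_ rows
  rows-inj {i} {j} e with i FP.≟ j
  ... | yes i≡j = i≡j
  ... | no  i≢j = contradiction (trans (sym (diag j)) (trans (cong (λ x → adj x (cols j)) (sym e))
                                  (offDiag j i i≢j))) true≢false
  -- a combination c of the rows has entry c i in column cols i, so c i = 0
  independent : ¬ RowsDependent G S rows
  independent (c , (i , cᵢ) , vanishes) = true≢false (begin
    true                                   ≡⟨ sym cᵢ ⟩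
    c i                                    ≡⟨ sym (BP.∧-identityʳ (c i)) ⟩
    c i ∧ true                             ≡⟨ cong (c i ∧_) (sym (diag i)) ⟩
    c i ∧ adj (rows i) (cols i)            ≡⟨ sym (xorSum-single _ i (λ j j≢i →
                                                 trans (cong (c j ∧_) (offDiag i j j≢i)) (BP.∧-zeroʳ (c j)))) ⟩
    xorSum (λ j → c j ∧ adj (rows j) (cols i)) ≡⟨ vanishes (cols i) (S-cols i) ⟩
    false                                  ∎)
    where open ≡-Reasoning

Radius2Centre : (T : Tree) → Fin (Tree.M T) → Set
Radius2Centre T c =
  ∀ v → (v ≡ c) ⊎ (Tree.A T c v ≡ true) ⊎ (∃ λ w → Tree.A T c w ≡ true × Tree.A T w v ≡ true)

≰⇒≤1 : ∀ {d} → ¬ (2 ≤ d) → d ≤ 1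
≰⇒≤1 ¬2≤d = ≤-pred (≰⇒> ¬2≤d)

leaf≢internal : (T : Tree) → ∀ {u v} → Tree.Leaf T u → Tree.Internal T v → u ≢ v
leaf≢internal T u-leaf v-int u≡v = 1+n≰n (≤-trans v-int (subst (Tree.Leaf T) u≡v u-leaf))

-- A radius-2 tree with an internal node has an internal centre of radius two: if
-- the centre c is a leaf, its unique neighbour is internal and is again a centre.
internalCentre : (T : Tree) → (∃ λ t → Tree.Internal T t) → Tree.RadiusAtMost2 T →
  Σ (Fin (Tree.M T)) λ c → Tree.Internal T c × Radius2Centre T c
internalCentre T (t , t-int) (c , c-centre) with 2 ≤? Tree.deg T c
... | yes c-int = c , c-int , c-centre
... | no  c-leaf = w , w-int , w-centre
  where
  open Tree T
  t≢c : t ≢ c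
  t≢c t≡c = c-leaf (subst Internal t≡c t-int)
  towards-t : Σ (Fin M) λ w → A c w ≡ true × ((w ≡ t) ⊎ (A w t ≡ true))
  towards-t with c-centre t
  ... | inj₁ t≡c                 = contradiction t≡c t≢c
  ... | inj₂ (inj₁ ct)            = t , ct , inj₁ refl
  ... | inj₂ (inj₂ (w , cw , wt)) = w , cw , inj₂ wt
  w : Fin M
  w = proj₁ towards-t
  cw : A c w ≡ true
  cw = proj₁ (proj₂ towards-t)
  only-neighbour : ∀ v → A c v ≡ true → v ≡ w
  only-neighbour v cv = count-≤1-unique (A c) v w (≰⇒≤1 c-leaf) cv cw
  w-centre : Radius2Centre T w
  w-centre v with c-centre v
  ... | inj₁ v≡c                  = inj₂ (inj₁ (subst (λ x → A w x ≡ true) (sym v≡c) (trans (symm w c) cw)))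
  ... | inj₂ (inj₁ cv)            = inj₁ (only-neighbour v cv)
  ... | inj₂ (inj₂ (u , cu , uv)) = inj₂ (inj₁ (subst (λ x → A x v ≡ true) (only-neighbour u cu) uv))
  w-int : Internal w
  w-int with proj₂ (proj₂ towards-t)
  ... | inj₁ w≡t = subst Internal (sym w≡t) t-int
  ... | inj₂ wt  = count-≥2 (A w) c t (trans (symm w c) cw) wt (λ c≡t → t≢c (sym c≡t))

walk-start : ∀ {M} {A : Fin M → Fin M → Bool} {P : Fin M → Set} {u v} → Walk A P u v → P u
walk-start (stay pu)     = pu
walk-start (step pu _ _) = pu

-- The branches of a tree around a centre c of radius two.  Every node u ≠ c has a
-- parent (c itself, or a neighbour of c), and its branch is the neighbour of c
-- through which it is reached.
module Branches (T : Tree) (c : Fin (Tree.M T)) (c-centre : Radius2Centre T c) where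
  open Tree T

  via : Fin M → Fin M
  via u with c-centre u
  ... | inj₂ (inj₂ (w , _)) = w
  ... | _                   = c

  via-spec : ∀ u → A c u ≡ false → u ≢ c → A c (via u) ≡ true × A (via u) u ≡ true
  via-spec u ¬cu u≢c with c-centre u
  ... | inj₁ u≡c                 = contradiction u≡c u≢c
  ... | inj₂ (inj₁ cu)            = contradiction (trans (sym cu) ¬cu) true≢false
  ... | inj₂ (inj₂ (_ , cw , wu)) = cw , wu

  parent : Fin M → Fin M
  parent u = if A c u then c else via u

  branch : Fin M → Fin M
  branch u = if A c u then u else via u

  parent-of-neighbour : ∀ u → A c u ≡ true → parent u ≡ c
  parent-of-neighbour u cu rewrite cu = refl

  parent-adj : ∀ u → u ≢ c → A u (parent u) ≡ true
  parent-adj u u≢c with A c u in cu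
  ... | true  = trans (symm u c) cu
  ... | false = trans (symm u _) (proj₂ (via-spec u cu u≢c))

  branch-adj : ∀ u → u ≢ c → A c (branch u) ≡ true
  branch-adj u u≢c with A c u in cu
  ... | true  = cu
  ... | false = proj₁ (via-spec u cu u≢c)

  branch-parent : ∀ u → branch u ≢ u → parent u ≡ branch u
  branch-parent u b≢u with A c u
  ... | true  = contradiction refl b≢u
  ... | false = refl

  mutual-parents : ∀ u v → u ≢ c → v ≢ c → parent u ≡ v → parent v ≡ u → ⊥
  mutual-parents u v u≢c v≢c pu≡v pv≡u with A c u in cu
  ... | true  = v≢c (sym pu≡v)
  ... | false = u≢c (trans (sym pv≡u) (parent-of-neighbour v
                  (subst (λ x → A c x ≡ true) pu≡v (proj₁ (via-spec u cu u≢c)))))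

  notCentre : Fin M → Bool
  notCentre u = not (c == u)

  notCentre-sound : ∀ u → notCentre u ≡ true → u ≢ c
  notCentre-sound u e u≡c rewrite u≡c | ==-refl c = true≢false (sym e)

  child : Fin M → Fin M → Bool
  child u v = notCentre u ∧ (parent u == v)

  treeEdge : Fin M → Fin M → Bool
  treeEdge u v = child u v ∨ child v u

  child-adj : ∀ u v → child u v ≡ true → A u v ≡ true
  child-adj u v e =
    subst (λ x → A u x ≡ true) (==-sound (∧-true₂ e)) (parent-adj u (notCentre-sound u (∧-true₁ e)))

  treeEdge-adj : ∀ u → treeEdge u ⊆ᵇ A u
  treeEdge-adj u v e with ∨-true {child u v} e
  ... | inj₁ uv = child-adj u v uv
  ... | inj₂ vu = trans (symm u v) (child-adj v u vu)

  child-asym : ∀ u v → child u v ∧ child v u ≡ false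
  child-asym u v with child u v in uv | child v u in vu
  ... | false | _     = refl
  ... | true  | false = refl
  ... | true  | true  = ⊥-elim (mutual-parents u v
          (notCentre-sound u (∧-true₁ uv)) (notCentre-sound v (∧-true₁ vu))
          (==-sound (∧-true₂ uv)) (==-sound (∧-true₂ vu)))

  count-child : ∀ u → count (child u) ≡ ind (notCentre u)
  count-child u with notCentre u
  ... | true  = count-single (parent u)
  ... | false = count-false {M}

  count-notCentre : count notCentre ≡ M ∸ 1
  count-notCentre = begin
    count notCentre                                ≡⟨ sym (m+n∸n≡m (count notCentre) 1) ⟩
    count notCentre + 1 ∸ 1                        ≡⟨ cong (λ x → count notCentre + x ∸ 1) (sym (count-single c)) ⟩
    count notCentre + count (λ u → c == u) ∸ 1     ≡⟨ cong (_∸ 1) (count-not (λ u → c == u)) ⟩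
    M ∸ 1                                          ∎
    where open ≡-Reasoning

  sum-children : sumFin (λ u → count (child u)) ≡ M ∸ 1
  sum-children = trans (sumFin-cong count-child) (trans (sym (count≡sum notCentre)) count-notCentre)

  sum-parents : sumFin (λ v → count (λ u → child u v)) ≡ M ∸ 1
  sum-parents = begin
    sumFin (λ v → count (λ u → child u v))         ≡⟨ sumFin-cong (λ v → count≡sum (λ u → child u v)) ⟩
    sumFin (λ v → sumFin (λ u → ind (child u v)))  ≡⟨ sym (sumFin-swap (λ u v → ind (child u v))) ⟩
    sumFin (λ u → sumFin (λ v → ind (child u v)))  ≡⟨ sumFin-cong (λ u → sym (count≡sum (child u))) ⟩
    sumFin (λ u → count (child u))                 ≡⟨ sum-children ⟩
    M ∸ 1                                          ∎
    where open ≡-Reasoning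

  treeEdge-degreeSum : sumFin (λ u → count (treeEdge u)) ≡ 2 * (M ∸ 1)
  treeEdge-degreeSum = begin
    sumFin (λ u → count (treeEdge u))
      ≡⟨ sumFin-cong (λ u → count-∨ (child u) (λ v → child v u) (child-asym u)) ⟩
    sumFin (λ u → count (child u) + count (λ v → child v u))
      ≡⟨ sumFin-+ (λ u → count (child u)) (λ u → count (λ v → child v u)) ⟩
    sumFin (λ u → count (child u)) + sumFin (λ u → count (λ v → child v u))
      ≡⟨ cong₂ _+_ sum-children sum-parents ⟩
    (M ∸ 1) + (M ∸ 1)
      ≡⟨ cong ((M ∸ 1) +_) (sym (+-identityʳ (M ∸ 1))) ⟩
    2 * (M ∸ 1)
      ∎
    where open ≡-Reasoning

  -- The tree has no edges besides the parent edges: these already account for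
  -- all 2(|V| - 1) edge ends that `edges` allows.
  adj⇒treeEdge : ∀ u v → A u v ≡ true → treeEdge u v ≡ true
  adj⇒treeEdge u v uv with treeEdge u v in ¬uv
  ... | true  = refl
  ... | false = contradiction
        (subst₂ _<_ treeEdge-degreeSum edges
          (sumFin-< (λ w → count-⊆ (treeEdge-adj w)) u (count-⊂ (treeEdge-adj u) v ¬uv uv)))
        (<-irrefl refl)

  branch-of-neighbour : ∀ v → A c v ≡ true → branch v ≡ v
  branch-of-neighbour v cv rewrite cv = refl

  branch-child : ∀ u v → u ≢ c → v ≢ c → parent u ≡ v → branch u ≡ branch v
  branch-child u v u≢c v≢c pu≡v with A c u in cu
  ... | true  = contradiction (sym pu≡v) v≢c
  ... | false = trans pu≡v (sym (branch-of-neighbour v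
                  (subst (λ x → A c x ≡ true) pu≡v (proj₁ (via-spec u cu u≢c)))))

  branch-edge : ∀ u v → u ≢ c → v ≢ c → A u v ≡ true → branch u ≡ branch v
  branch-edge u v u≢c v≢c uv with ∨-true {child u v} (adj⇒treeEdge u v uv)
  ... | inj₁ u→v = branch-child u v u≢c v≢c (==-sound (∧-true₂ u→v))
  ... | inj₂ v→u = sym (branch-child v u v≢c u≢c (==-sound (∧-true₂ v→u)))

  branch-walk : ∀ {u v} → Walk A (λ z → z ≢ c) u v → branch u ≡ branch v
  branch-walk (stay _)                = refl
  branch-walk (step {u} {w} u≢c uw rest) =
    trans (branch-edge u w u≢c (walk-start rest) uw) (branch-walk rest)

  hangs-from-branch : ∀ u → u ≢ c → branch u ≢ u → A (branch u) u ≡ true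
  hangs-from-branch u u≢c b≢u =
    trans (symm _ u) (subst (λ x → A u x ≡ true) (branch-parent u b≢u) (parent-adj u u≢c))

  branch-leaf : ∀ u → u ≢ c → Leaf (branch u) → branch u ≡ u
  branch-leaf u u≢c b-leaf with branch u FP.≟ u
  ... | yes b≡u = b≡u
  ... | no  b≢u = contradiction
        (count-≤1-unique (A (branch u)) c u b-leaf
           (trans (symm _ c) (branch-adj u u≢c)) (hangs-from-branch u u≢c b≢u))
        (λ c≡u → u≢c (sym c≡u))

  -- Every branch has an internal "hub" adjacent to all leaves of the branch: the
  -- branch node itself if it is internal, and c otherwise.
  branchHub : Internal c → ∀ β →
    Σ (Fin M) λ t → Internal t × (∀ ℓ → Leaf ℓ → branch ℓ ≡ β → A t ℓ ≡ true)
  branchHub c-int β with 2 ≤? deg β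
  ... | yes β-int = β , β-int , β-hub
    where
    β-hub : ∀ ℓ → Leaf ℓ → branch ℓ ≡ β → A β ℓ ≡ true
    β-hub ℓ ℓ-leaf bℓ≡β = subst (λ x → A x ℓ ≡ true) bℓ≡β
      (hangs-from-branch ℓ (leaf≢internal T ℓ-leaf c-int)
        (λ bℓ≡ℓ → leaf≢internal T ℓ-leaf β-int (trans (sym bℓ≡ℓ) bℓ≡β)))
  ... | no  β-leaf = c , c-int , c-hub
    where
    c-hub : ∀ ℓ → Leaf ℓ → branch ℓ ≡ β → A c ℓ ≡ true
    c-hub ℓ ℓ-leaf bℓ≡β = subst (λ x → A c x ≡ true)
      (branch-leaf ℓ ℓ≢c (subst Leaf (sym bℓ≡β) (≰⇒≤1 β-leaf))) (branch-adj ℓ ℓ≢c)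
      where
      ℓ≢c : ℓ ≢ c
      ℓ≢c = leaf≢internal T ℓ-leaf c-int

module PendantLeaf (T : Tree) where
  open Tree T

  walk-from-pendant : ∀ t {a b} → Leaf a → A t a ≡ true → Walk A (λ z → z ≢ t) a b → a ≡ b
  walk-from-pendant t a-leaf ta (stay _) = refl
  walk-from-pendant t {a} a-leaf ta (step {w = w} _ aw rest) =
    contradiction (count-≤1-unique (A a) w t a-leaf aw (trans (symm a t) ta)) (walk-start rest)

  walk-to-pendant : ∀ t {a b} → Leaf b → A t b ≡ true → Walk A (λ z → z ≢ t) a b → a ≡ b
  walk-to-pendant t b-leaf tb (stay _) = refl
  walk-to-pendant t {a} {b} b-leaf tb (step a≢t aw rest) with walk-to-pendant t b-leaf tb rest
  ... | refl = contradiction (count-≤1-unique (A b) a t b-leaf (trans (symm b a) aw) (trans (symm b t) tb)) a≢t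

module _ {G : Graph} (D : Decomposition G) where
  open Decomposition D
  open PendantLeaf tree

  pendantLeaves-union : ∀ t (X : Fin (Graph.N G) → Bool) →
    (∀ x → X x ≡ true → Tree.A tree t (σ x) ≡ true) → UnionOfParts D t X
  pendantLeaves-union t X X-pendant x y walk with X x in Xx | X y in Xy
  ... | true  | _     = trans (sym Xx) (trans (cong X
                          (σ-injective (walk-from-pendant t (σ-leaf x) (X-pendant x Xx) walk))) Xy)
  ... | false | true  = trans (sym Xx) (trans (cong X
                          (σ-injective (walk-to-pendant t (σ-leaf y) (X-pendant y Xy) walk))) Xy)
  ... | false | false = refl

T⇒true : ∀ {b} → T b → b ≡ true
T⇒true {true} _ = refl

¬T⇒false : ∀ {b} → ¬ T b → b ≡ false
¬T⇒false {false} _   = refl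
¬T⇒false {true}  ¬tt = contradiction _ ¬tt

≡ᵇ-refl : ∀ m → (m ≡ᵇ m) ≡ true
≡ᵇ-refl m = T⇒true (≡⇒≡ᵇ m m refl)

≡ᵇ-≢ : ∀ {m m′} → m ≢ m′ → (m ≡ᵇ m′) ≡ false
≡ᵇ-≢ {m} {m′} m≢m′ = ¬T⇒false (λ t → m≢m′ (≡ᵇ⇒≡ m m′ t))

<ᵇ-< : ∀ {m m′} → m < m′ → (m <ᵇ m′) ≡ true
<ᵇ-< m<m′ = T⇒true (<⇒<ᵇ m<m′)

<ᵇ-+ : ∀ m m′ → (m′ + m <ᵇ m′) ≡ false
<ᵇ-+ m m′ = ¬T⇒false (λ t → <⇒≱ (<ᵇ⇒< (m′ + m) m′ t) (m≤m+n m′ m))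

-- Named vertices of nT_{2,n}: in copy p, the centre, the j-th subdivision vertex
-- (local index 1+j) and the j-th leaf (local index 1+n+j).
module Copies (n : ℕ) where
  Vertex : Set
  Vertex = Fin (Graph.N (nT2 n))

  adj : Vertex → Vertex → Bool
  adj = Graph.adj (nT2 n)

  centreV : Fin n → Vertex
  centreV p = combine p F.zero

  midV : Fin n → Fin n → Vertex
  midV p j = combine p (F.suc (j ↑ˡ n))

  leafV : Fin n → Fin n → Vertex
  leafV p j = combine p (F.suc (n ↑ʳ j))

  adj-combine : ∀ (p q : Fin n) (a b : Fin (suc (n + n))) →
    adj (combine p a) (combine q b) ≡
    ((toℕ p ≡ᵇ toℕ q) ∧ (localEdge n (toℕ a) (toℕ b) ∨ localEdge n (toℕ b) (toℕ a)))
  adj-combine p q a b =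
    cong₂ adjLocal (FP.remQuot-combine {n} {suc (n + n)} p a) (FP.remQuot-combine {n} {suc (n + n)} q b)
    where
    adjLocal : Fin n × Fin (suc (n + n)) → Fin n × Fin (suc (n + n)) → Bool
    adjLocal (p , a) (q , b) =
      (toℕ p ≡ᵇ toℕ q) ∧ (localEdge n (toℕ a) (toℕ b) ∨ localEdge n (toℕ b) (toℕ a))

  isMidLocal : Fin n × Fin (suc (n + n)) → Bool
  isMidLocal (_ , a) = (1 ≤ᵇ toℕ a) ∧ (toℕ a ≤ᵇ n)

  isMid : Vertex → Bool
  isMid x = isMidLocal (remQuot {n} (suc (n + n)) x)

  isMid-midV : ∀ p j → isMid (midV p j) ≡ true
  isMid-midV p j = begin
    isMid (midV p j)                 ≡⟨ cong isMidLocal (FP.remQuot-combine {n} {suc (n + n)} p _) ⟩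
    toℕ (j ↑ˡ n) <ᵇ n               ≡⟨ cong (_<ᵇ n) (FP.toℕ-↑ˡ j n) ⟩
    toℕ j <ᵇ n                       ≡⟨ <ᵇ-< (FP.toℕ<n j) ⟩
    true                             ∎
    where open ≡-Reasoning

  isMid-leafV : ∀ p j → isMid (leafV p j) ≡ false
  isMid-leafV p j = begin
    isMid (leafV p j)                ≡⟨ cong isMidLocal (FP.remQuot-combine {n} {suc (n + n)} p _) ⟩
    toℕ (n ↑ʳ j) <ᵇ n               ≡⟨ cong (_<ᵇ n) (FP.toℕ-↑ʳ n j) ⟩
    n + toℕ j <ᵇ n                   ≡⟨ <ᵇ-+ (toℕ j) n ⟩
    false                            ∎
    where open ≡-Reasoning

  centre-mid : ∀ p j → adj (centreV p) (midV p j) ≡ true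
  centre-mid p j rewrite adj-combine p p F.zero (F.suc (j ↑ˡ n)) | ≡ᵇ-refl (toℕ p)
    | FP.toℕ-↑ˡ j n | <ᵇ-< (FP.toℕ<n j) = refl

  centre-mid-other : ∀ p q j → p ≢ q → adj (centreV p) (midV q j) ≡ false
  centre-mid-other p q j p≢q rewrite adj-combine p q F.zero (F.suc (j ↑ˡ n))
    | ≡ᵇ-≢ (λ e → p≢q (FP.toℕ-injective e)) = refl

  mid-leaf : ∀ p j → adj (midV p j) (leafV p j) ≡ true
  mid-leaf p j rewrite adj-combine p p (F.suc (j ↑ˡ n)) (F.suc (n ↑ʳ j)) | ≡ᵇ-refl (toℕ p)
    | FP.toℕ-↑ˡ j n | FP.toℕ-↑ʳ n j | <ᵇ-< (FP.toℕ<n j)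
    | T⇒true (≡⇒≡ᵇ (n + toℕ j) (toℕ j + n) (+-comm n (toℕ j))) = refl

  mid-leaf-other : ∀ p j j′ → j ≢ j′ → adj (midV p j) (leafV p j′) ≡ false
  mid-leaf-other p j j′ j≢j′ rewrite adj-combine p p (F.suc (j ↑ˡ n)) (F.suc (n ↑ʳ j′)) | ≡ᵇ-refl (toℕ p)
    | FP.toℕ-↑ˡ j n | FP.toℕ-↑ʳ n j′ | <ᵇ-< (FP.toℕ<n j) | <ᵇ-+ (toℕ j′) n
    | ≡ᵇ-≢ {n + toℕ j′} {toℕ j + n}
        (λ e → j≢j′ (FP.toℕ-injective (sym (+-cancelˡ-≡ n _ _ (trans e (+-comm (toℕ j) n)))))) = refl

module Refutation (k : ℕ) (D : Decomposition (nT2 (suc k * suc k)))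
  (shallow : Tree.RadiusAtMost2 (Decomposition.tree D)) (narrow : WidthAtMost D k) where
  n : ℕ
  n = suc k * suc k
  open Copies n
  open Decomposition D
  open Tree tree

  c-data : Σ (Fin M) λ c → Internal c × Radius2Centre tree c
  c-data = internalCentre tree hasInternal shallow

  c : Fin M
  c = proj₁ c-data

  c-int : Internal c
  c-int = proj₁ (proj₂ c-data)

  open Branches tree c (proj₂ (proj₂ c-data))

  B : Vertex → Fin M
  B x = branch (σ x)

  -- No branch contains k+1 subdivision vertices of a single copy q: with their
  -- leaves they would form an induced matching across a cut at the branch's hub.
  fewPerBranch : ∀ β q (g : Fin (suc k) → Fin n) → Injective _≡_ _≡_ g →
    (∀ i → B (midV q (g i)) ≡ β) → ⊥
  fewPerBranch β q g g-inj g-β =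
    narrow t t-int X X-union (matching⇒cutRank (nT2 n) X rows cols X-rows X-cols diag offDiag)
    where
    t : Fin M
    t = proj₁ (branchHub c-int β)
    t-int : Internal t
    t-int = proj₁ (proj₂ (branchHub c-int β))
    X : Vertex → Bool
    X x = (B x == β) ∧ isMid x
    X-union : UnionOfParts D t X
    X-union = pendantLeaves-union D t X
      (λ x Xx → proj₂ (proj₂ (branchHub c-int β)) (σ x) (σ-leaf x) (==-sound (∧-true₁ Xx)))
    rows cols : Fin (suc k) → Vertex
    rows i = midV q (g i)
    cols i = leafV q (g i)
    X-rows : ∀ i → X (rows i) ≡ true
    X-rows i rewrite g-β i | ==-refl β = isMid-midV q (g i)
    X-cols : ∀ i → X (cols i) ≡ false
    X-cols i rewrite isMid-leafV q (g i) = BP.∧-zeroʳ _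
    diag : ∀ i → adj (rows i) (cols i) ≡ true
    diag i = mid-leaf q (g i)
    offDiag : ∀ i j → j ≢ i → adj (rows j) (cols i) ≡ false
    offDiag i j j≢i = mid-leaf-other q (g j) (g i) (λ e → j≢i (g-inj e))

  early : Fin (suc k) → Fin n
  early q = q ↑ˡ (k * suc k)

  early-inj : Injective _≡_ _≡_ early
  early-inj {p} {q} = FP.↑ˡ-injective (k * suc k) p q

  centreBranch : Fin (suc k) → Fin M
  centreBranch q = B (centreV (early q))

  inS : Fin M → Bool
  inS β = does (any? (λ q → β FP.≟ centreBranch q))

  inS-sound : ∀ β → inS β ≡ true → ∃ λ q → β ≡ centreBranch q
  inS-sound β = does-sound (any? (λ q → β FP.≟ centreBranch q))

  S : Vertex → Bool
  S x = inS (B x)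

  S-union : UnionOfParts D c S
  S-union x y walk = cong inS (branch-walk walk)

  -- Each early copy has a subdivision vertex outside S; otherwise its n = (k+1)²
  -- subdivision vertices lie in k+1 branches, and one branch would get k+1 of them.
  outsideS : ∀ q → Σ (Fin n) λ j → S (midV (early q) j) ≡ false
  outsideS q with any? (λ j → S (midV (early q) j) BP.≟ false)
  ... | yes found = found
  ... | no  none  = ⊥-elim (fewPerBranch (centreBranch v) (early q) g g-inj
                      (λ i → trans (owner-spec (g i)) (cong centreBranch (g-v i))))
    where
    in-S : ∀ j → S (midV (early q) j) ≡ true
    in-S j = BP.¬-not (λ e → none (j , e))
    owner : Fin n → Fin (suc k)
    owner j = proj₁ (inS-sound _ (in-S j))
    owner-spec : ∀ j → B (midV (early q) j) ≡ centreBranch (owner j)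
    owner-spec j = proj₂ (inS-sound _ (in-S j))
    crowded : Σ (Fin (suc k)) λ v → Σ (Fin (suc k) → Fin n) λ g →
                Injective _≡_ _≡_ g × (∀ i → owner (g i) ≡ v)
    crowded = pigeonhole k owner (*-monoʳ-< (suc k) (n<1+n k))
    v : Fin (suc k)
    v = proj₁ crowded
    g : Fin (suc k) → Fin n
    g = proj₁ (proj₂ crowded)
    g-inj : Injective _≡_ _≡_ g
    g-inj = proj₁ (proj₂ (proj₂ crowded))
    g-v : ∀ i → owner (g i) ≡ v
    g-v = proj₂ (proj₂ (proj₂ crowded))

  absurd : ⊥
  absurd = narrow c c-int S S-union (matching⇒cutRank (nT2 n) S rows cols S-rows S-cols diag offDiag)
    where
    rows cols : Fin (suc k) → Vertex
    rows q = centreV (early q)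
    cols q = midV (early q) (proj₁ (outsideS q))
    S-rows : ∀ q → S (rows q) ≡ true
    S-rows q = dec-true (any? (λ q′ → centreBranch q FP.≟ centreBranch q′)) (q , refl)
    S-cols : ∀ q → S (cols q) ≡ false
    S-cols q = proj₂ (outsideS q)
    diag : ∀ q → adj (rows q) (cols q) ≡ true
    diag q = centre-mid (early q) _
    offDiag : ∀ i j → j ≢ i → adj (rows j) (cols i) ≡ false
    offDiag i j j≢i = centre-mid-other (early j) (early i) _ (λ e → j≢i (early-inj e))

lemma5p1 : ¬ (∃ λ k → ∀ n → 1 ≤ n → Rb2AtMost (nT2 n) k)
lemma5p1 (k , rb₂≤k) with rb₂≤k (suc k * suc k) (s≤s z≤n)
... | inj₁ (s≤s (s≤s ()))
... | inj₂ (D , shallow , narrow) = Refutation.absurd k D shallow narrow
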